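{- For all integers $k>\ell\ge2$ and every integer $q\ge2$, there exists $s=s(k,\ell,q)>0$ such that the following holds. For every $\mathcal{I}\subseteq\binom{[k]}{\ell}$ there exists a $k$-partite set system $\mathcal{F}$ with parts $X^{(1)},\dots,X^{(k)}$ such that (a) $|\mathcal{F}|=s$; (b) $\mathcal{I}\subseteq\pi(I(F,\mathcal{F}))\subseteq\mathcal{I}\cup\binom{[k]}{0}\cup\binom{[k]}{1}\cup\dots\cup\binom{[k]}{\ell-1}$ for every $F\in\mathcal{F}$, where $\pi$ is the projection with respect to the partition $X^{(1)},\dots,X^{(k)}$; (c) for every $I\in\mathcal{I}$, the family $\mathcal{F}$ can be partitioned into sunflowers with at least $q$ petals each, such that every one of these sunflowers has kernel of the form $\{x^{(i)}:i\in I\}$ with $x^{(i)}\in X^{(i)}$ for all $i\in I$.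
   Context: A set system $\mathcal F$ is $k$-partite with parts $X^{(1)},\dots,X^{(k)}$ (disjoint sets) if every member of $\mathcal F$ contains exactly one element of each $X^{(i)}$ and no other elements. The projection $\pi$ sends an element of $X^{(i)}$ to $i$; $\pi(A)=\{\pi(a):a\in A\}$ and $\pi(\mathcal J)=\{\pi(J):J\in\mathcal J\}$. For $F\in\mathcal F$, $I(F,\mathcal F)=\{F\cap F':F'\in\mathcal F\setminus\{F\}\}$. A sunflower with $t$ petals is a collection of distinct sets $F_1,\dots,F_t$ with $F_i\cap F_j=\bigcap_\ell F_\ell$ for all $i\ne j$; the common intersection is the kernel. $\binom{[k]}{j}$ denotes the $j$-element subsets of $\{1,\dots,k\}$. -}

module Defs where

open import Data.Nat using (ℕ; _<_; _≤_; _≟_)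
open import Data.Fin using (Fin)
open import Data.Fin.Subset using (Subset; ∣_∣) renaming (_∈_ to _∈ₛ_)
open import Data.Product using (Σ; ∃; _×_; _,_)
open import Data.Sum using (_⊎_)
open import Data.List using (List; length; filter; allFin)
open import Data.List.Membership.Propositional using () renaming (_∈_ to _∈ₗ_)
open import Relation.Binary.PropositionalEquality using (_≡_; _≢_)
open import Relation.Nullary using (¬_)
open import Function.Bundles using (_⇔_)

-- Ground set: element (i , x) is the element x of part X^(i) = {i} × ℕ.
-- Parts are thus disjoint; π (i , x) = i.
Elem : ℕ → Set
Elem k = Fin k × ℕ

SetOf : ℕ → Set₁
SetOf k = Elem k → Set

_∩_ : ∀ {k} → SetOf k → SetOf k → SetOf k
(A ∩ B) e = A e × B e

_≐_ : ∀ {k} → SetOf k → SetOf k → Set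
A ≐ B = ∀ e → A e ⇔ B e

-- A member of a k-partite set system contains exactly one element of each
-- part X^(i) and no other elements: it is determined by a choice f : Fin k → ℕ.
Member : ℕ → Set
Member k = Fin k → ℕ

toSet : ∀ {k} → Member k → SetOf k
toSet f (i , x) = f i ≡ x

proj : ∀ {k} → SetOf k → Fin k → Set
proj A i = ∃ λ x → A (i , x)

-- A k-partite set system with s members, indexed by Fin s; members are distinct
-- as sets, so |𝓕| = s.
Distinct : ∀ {k s} → (Fin s → Member k) → Set
Distinct 𝓕 = ∀ a b → a ≢ b → ¬ (toSet (𝓕 a) ≐ toSet (𝓕 b))

-- S ∈ π(I(F_a, 𝓕)) : S = π(F_a ∩ F_b) for some member F_b ≠ F_a
InProjI : ∀ {k s} → (Fin s → Member k) → Fin s → Subset k → Set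
InProjI 𝓕 a S =
  ∃ λ b → b ≢ a × (∀ i → (i ∈ₛ S) ⇔ proj (toSet (𝓕 a) ∩ toSet (𝓕 b)) i)

CondB : ∀ {k s} → ℕ → List (Subset k) → (Fin s → Member k) → Fin s → Set
CondB ℓ 𝓘 𝓕 a =
  (∀ I → I ∈ₗ 𝓘 → InProjI 𝓕 a I) ×
  (∀ S → InProjI 𝓕 a S → (S ∈ₗ 𝓘) ⊎ (∣ S ∣ < ℓ))

Kernel : ∀ {k s} → (Fin s → Member k) → (Fin s → Set) → SetOf k
Kernel 𝓕 P e = ∀ b → P b → toSet (𝓕 b) e

Sunflower : ∀ {k s} → (Fin s → Member k) → (Fin s → Set) → Set
Sunflower 𝓕 P = ∀ b b' → P b → P b' → b ≢ b' →
  (toSet (𝓕 b) ∩ toSet (𝓕 b')) ≐ Kernel 𝓕 P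

-- Condition (c) for I: a partition of 𝓕 (given by class labels c) into
-- sunflowers, each with ≥ q petals and kernel {x^(i) : i ∈ I}, x^(i) ∈ X^(i).
SunflowerPartition : ∀ {k s} → (Fin s → Member k) → ℕ → Subset k → Set
SunflowerPartition {k} {s} 𝓕 q I =
  Σ (Fin s → ℕ) λ c → ∀ a →
    (q ≤ length (filter (λ b → c b ≟ c a) (allFin s))) ×
    Sunflower 𝓕 (λ b → c b ≡ c a) ×
    (∃ λ (x : Fin k → ℕ) →
       Kernel 𝓕 (λ b → c b ≡ c a) ≐ (λ { (i , y) → (i ∈ₛ I) × (y ≡ x i) }))

{-# OPTIONS --safe #-}
-- Index the members by all tables a : 2^[k] → [q] and let the i-th coordinate of F_a be the table
-- a with its entries at the sets S ∈ 𝓘 containing i blanked out. Then F_a and F_b share their element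
-- of X^(i) iff every set at which a and b differ lies in 𝓘 and contains i, so π(F_a ∩ F_b) is the
-- intersection of these sets, or ∅. A single difference, at I, gives I; two or more give a subset of
-- two distinct ℓ-sets, which has fewer than ℓ elements. The q tables that agree with a outside the
-- entry I pairwise differ exactly at I, so their members form a sunflower whose kernel is F_a on the
-- parts in I.
module Submission where

open import Defs
open import Data.Nat using (ℕ; _<_; _≤_)
open import Data.Fin using (Fin)
open import Data.Fin.Subset using (Subset; ∣_∣)
open import Data.Product using (Σ; _×_)
open import Data.List using (List)
open import Data.List.Relation.Unary.All using (All)
open import Data.List.Membership.Propositional using (_∈_)
open import Relation.Binary.PropositionalEquality using (_≡_)

open import Data.Bool using (if_then_else_)
import Data.Bool as Bool
open import Data.Nat using (zero; suc; _*_; s≤s; z≤n)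
import Data.Nat as ℕ
open import Data.Nat.Properties using (<-irrefl; ≤-trans)
open import Data.Fin using (toℕ; fromℕ<; combine; remQuot; punchIn)
open import Data.Fin.Properties
  using (toℕ-injective; remQuot-combine; combine-remQuot; punchInᵢ≢i; injective⇒≤; any?; nonZeroIndex)
  renaming (_≟_ to _≟ᶠ_)
open import Data.Fin.Subset
  using (_⊆_; _⊂_; ⊤; outside; inside) renaming (_∈_ to _∈ₛ_; _∉_ to _∉ₛ_)
open import Data.Fin.Subset.Properties
  using (_∈?_; ⊆-antisym; ⊆⊤; ∣⊤∣≡n; ∣⊥∣≡0; Empty-unique; nonempty?; p⊂q⇒∣p∣<∣q∣; anySubset?)
open import Data.Fin.Patterns using (0F)
open import Data.Vec using (_∷_; [])
open import Data.Vec.Properties using (≡-dec)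
open import Data.Product using (∃; _,_; proj₁; proj₂; uncurry)
import Data.Product as Product
open import Data.Sum using (_⊎_; inj₁; inj₂)
open import Data.List using (length; filter; allFin)
import Data.List.Relation.Unary.All as All
import Data.List.Relation.Unary.Any as Any
open import Data.List.Membership.Propositional.Properties using (∈-filter⁺; ∈-allFin)
open import Data.List.Membership.Setoid.Properties using (index-injective)
import Data.List.Membership.DecPropositional as DecMembership
open import Function using (_∘_)
open import Function.Bundles using (_⇔_; mk⇔; Equivalence)
import Function.Properties.Equivalence as ⇔
open import Function.Definitions using (Injective)
open import Level using (0ℓ)
open import Relation.Binary.Definitions using (DecidableEquality)
open import Relation.Binary.Core using (Rel)
open import Relation.Binary.PropositionalEquality
  using (_≢_; refl; sym; trans; cong; cong₂; subst; setoid; ≢-sym; module ≡-Reasoning)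
open import Relation.Nullary using (¬_; Dec; yes; no; does; ¬?; _×-dec_; contradiction)
open import Relation.Nullary.Decidable using (dec-true; dec-false; decidable-stable)
open import Relation.Unary using (Pred; Decidable)

open Equivalence using (to; from)

_≟ₛ_ : ∀ {n} → DecidableEquality (Subset n)
_≟ₛ_ = ≡-dec Bool._≟_

-- Fin (Size k) encodes the tables Subset k → Fin q; Size k = q ^ 2 ^ k.
module Table (q : ℕ) where

  Size : ℕ → ℕ
  Size zero    = q
  Size (suc k) = Size k * Size k

  lookup : ∀ {k} → Fin (Size k) → Subset k → Fin q
  lookup {zero}  a []            = a
  lookup {suc k} a (outside ∷ S) = lookup (proj₁ (remQuot {Size k} (Size k) a)) S
  lookup {suc k} a (inside  ∷ S) = lookup (proj₂ (remQuot {Size k} (Size k) a)) S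

  tabulate : ∀ {k} → (Subset k → Fin q) → Fin (Size k)
  tabulate {zero}  g = g []
  tabulate {suc k} g = combine (tabulate (g ∘ (outside ∷_))) (tabulate (g ∘ (inside ∷_)))

  lookup∘tabulate : ∀ {k} (g : Subset k → Fin q) (S : Subset k) → lookup (tabulate g) S ≡ g S
  lookup∘tabulate {zero}  g []            = refl
  lookup∘tabulate {suc k} g (outside ∷ S) =
    trans (cong (λ r → lookup (proj₁ r) S) (remQuot-combine {Size k} (tabulate (g ∘ (outside ∷_))) _))
          (lookup∘tabulate (g ∘ (outside ∷_)) S)
  lookup∘tabulate {suc k} g (inside ∷ S) =
    trans (cong (λ r → lookup (proj₂ r) S) (remQuot-combine {Size k} _ (tabulate (g ∘ (inside ∷_)))))
          (lookup∘tabulate (g ∘ (inside ∷_)) S)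

  lookup-injective : ∀ {k} {a b : Fin (Size k)} → (∀ (S : Subset k) → lookup a S ≡ lookup b S) → a ≡ b
  lookup-injective {zero}          a≗b = a≗b []
  lookup-injective {suc k} {a} {b} a≗b = begin
    a                                             ≡⟨ combine-remQuot {Size k} (Size k) a ⟨
    uncurry combine (remQuot {Size k} (Size k) a) ≡⟨ cong₂ combine (lookup-injective (a≗b ∘ (outside ∷_)))
                                                                   (lookup-injective (a≗b ∘ (inside ∷_))) ⟩
    uncurry combine (remQuot {Size k} (Size k) b) ≡⟨ combine-remQuot {Size k} (Size k) b ⟩
    b                                             ∎
    where open ≡-Reasoning

  module _ {k : ℕ} where

    ≢⇒∃lookup≢ : ∀ {a b : Fin (Size k)} → a ≢ b → ∃ λ S → lookup a S ≢ lookup b S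
    ≢⇒∃lookup≢ {a} {b} a≢b with anySubset? (λ (S : Subset k) → ¬? (lookup a S ≟ᶠ lookup b S))
    ... | yes found = found
    ... | no ∄S = contradiction
      (lookup-injective λ (S : Subset k) → decidable-stable (lookup a S ≟ᶠ lookup b S) (∄S ∘ (S ,_))) a≢b

    AgreeOutside : ∀ {p} → Pred (Subset k) p → Rel (Fin (Size k)) p
    AgreeOutside P a b = ∀ S → ¬ P S → lookup a S ≡ lookup b S

    lookup-injectiveAt : ∀ {a b : Fin (Size k)} {T} →
      AgreeOutside (_≡ T) a b → lookup a T ≡ lookup b T → a ≡ b
    lookup-injectiveAt {a} {b} {T} a~b a≡bAtT = lookup-injective λ (S : Subset k) → agree S (S ≟ₛ T)
      where
      agree : ∀ S → Dec (S ≡ T) → lookup a S ≡ lookup b S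
      agree S (yes refl) = a≡bAtT
      agree S (no S≢T)   = a~b S S≢T

    module _ {p} {P : Pred (Subset k) p} (P? : Decidable P) (t : Fin q) where

      overwrite : Fin (Size k) → Fin (Size k)
      overwrite a = tabulate λ S → if does (P? S) then t else lookup a S

      lookup∘overwrite : ∀ {a S} → P S → lookup (overwrite a) S ≡ t
      lookup∘overwrite {a} {S} PS
        rewrite lookup∘tabulate (λ S → if does (P? S) then t else lookup a S) S | dec-true (P? S) PS = refl

      lookup∘overwrite′ : ∀ {a S} → ¬ P S → lookup (overwrite a) S ≡ lookup a S
      lookup∘overwrite′ {a} {S} ¬PS
        rewrite lookup∘tabulate (λ S → if does (P? S) then t else lookup a S) S | dec-false (P? S) ¬PS = refl

      overwrite-≡⇔ : ∀ {a b} → overwrite a ≡ overwrite b ⇔ AgreeOutside P a b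
      overwrite-≡⇔ {a} {b} = mk⇔ agree overwrite-cong
        where
        agree : overwrite a ≡ overwrite b → AgreeOutside P a b
        agree eq S ¬PS = begin
          lookup a S             ≡⟨ lookup∘overwrite′ ¬PS ⟨
          lookup (overwrite a) S ≡⟨ cong (λ c → lookup c S) eq ⟩
          lookup (overwrite b) S ≡⟨ lookup∘overwrite′ ¬PS ⟩
          lookup b S             ∎
          where open ≡-Reasoning
        overwrite-cong : AgreeOutside P a b → overwrite a ≡ overwrite b
        overwrite-cong a~b = lookup-injective λ (S : Subset k) → pointwise S (P? S)
          where
          pointwise : ∀ S → Dec (P S) → lookup (overwrite a) S ≡ lookup (overwrite b) S
          pointwise S (yes PS) = trans (lookup∘overwrite PS) (sym (lookup∘overwrite PS))
          pointwise S (no ¬PS) =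
            trans (lookup∘overwrite′ ¬PS) (trans (a~b S ¬PS) (sym (lookup∘overwrite′ ¬PS)))

proj-∩⇔ : ∀ {k} (f g : Member k) i → proj (toSet f ∩ toSet g) i ⇔ f i ≡ g i
proj-∩⇔ f g i = mk⇔ (λ (_ , fi≡x , gi≡x) → trans fi≡x (sym gi≡x)) (λ fi≡gi → f i , refl , sym fi≡gi)

toSet-≐⇒≗ : ∀ {k} {f g : Member k} → toSet f ≐ toSet g → ∀ i → f i ≡ g i
toSet-≐⇒≗ {f = f} f≐g i = sym (to (f≐g (i , f i)) refl)

injection⇒≤-length-filter : ∀ {s q p} {P : Pred (Fin s) p} (P? : Decidable P) (f : Fin q → Fin s) →
  (∀ t → P (f t)) → Injective _≡_ _≡_ f → q ≤ length (filter P? (allFin s))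
injection⇒≤-length-filter P? f Pf f-injective = injective⇒≤ index-injective′
  where
  f∈ : ∀ t → f t ∈ filter P? (allFin _)
  f∈ t = ∈-filter⁺ P? (∈-allFin (f t)) (Pf t)
  index-injective′ : Injective _≡_ _≡_ (λ t → Any.index (f∈ t))
  index-injective′ eq = f-injective (index-injective (setoid _) (f∈ _) (f∈ _) eq)

∣p∣<n⇒∃∉ : ∀ {n} (p : Subset n) → ∣ p ∣ < n → ∃ λ i → i ∉ₛ p
∣p∣<n⇒∃∉ {n} p ∣p∣<n with any? (λ i → ¬? (i ∈? p))
... | yes found = found
... | no ∄i = contradiction (subst (_< n) (trans (cong ∣_∣ p≡⊤) (∣⊤∣≡n n)) ∣p∣<n) (<-irrefl refl)
  where
  p≡⊤ : p ≡ ⊤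
  p≡⊤ = ⊆-antisym ⊆⊤ λ {i} _ → decidable-stable (i ∈? p) (∄i ∘ (i ,_))

⊆∧≢⇒⊂ : ∀ {n} {p r : Subset n} → p ⊆ r → p ≢ r → p ⊂ r
⊆∧≢⇒⊂ {p = p} {r} p⊆r p≢r with any? (λ i → i ∈? r ×-dec ¬? (i ∈? p))
... | yes (i , i∈r , i∉p) = p⊆r , i , i∈r , i∉p
... | no ∄i = contradiction
  (⊆-antisym p⊆r λ {i} i∈r → decidable-stable (i ∈? p) (λ i∉p → ∄i (i , i∈r , i∉p))) p≢r

⊆-distinct-equal-size⇒< : ∀ {n} {p r r′ : Subset n} →
  p ⊆ r → p ⊆ r′ → r ≢ r′ → ∣ r ∣ ≡ ∣ r′ ∣ → ∣ p ∣ < ∣ r ∣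
⊆-distinct-equal-size⇒< {p = p} {r} p⊆r p⊆r′ r≢r′ ∣r∣≡∣r′∣ with p ≟ₛ r
... | yes refl =
  contradiction (subst (∣ p ∣ <_) (sym ∣r∣≡∣r′∣) (p⊂q⇒∣p∣<∣q∣ (⊆∧≢⇒⊂ p⊆r′ r≢r′))) (<-irrefl refl)
... | no p≢r = p⊂q⇒∣p∣<∣q∣ (⊆∧≢⇒⊂ p⊆r p≢r)

module Construction (k ℓ q′ : ℕ) (𝓘 : List (Subset k))
  (∣𝓘∣≡ℓ : All (λ I → ∣ I ∣ ≡ ℓ) 𝓘) (ℓ<k : ℓ < k) (0<ℓ : 0 < ℓ) where

  q : ℕ
  q = suc (suc q′)

  open Table q
  open DecMembership (_≟ₛ_ {k}) using () renaming (_∈?_ to _∈𝓘?_)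

  s : ℕ
  s = Size k

  Hidden : Fin k → Pred (Subset k) 0ℓ
  Hidden i S = S ∈ 𝓘 × i ∈ₛ S

  hidden? : ∀ i → Decidable (Hidden i)
  hidden? i S = S ∈𝓘? 𝓘 ×-dec i ∈? S

  𝓕 : Fin s → Member k
  𝓕 a i = toℕ (overwrite (hidden? i) 0F a)

  𝓕-≡⇔ : ∀ {a b} i → 𝓕 a i ≡ 𝓕 b i ⇔ AgreeOutside (Hidden i) a b
  𝓕-≡⇔ i = ⇔.trans (mk⇔ toℕ-injective (cong toℕ)) (overwrite-≡⇔ (hidden? i) 0F)

  𝓕-≡⇒hidden : ∀ {a b S} i → 𝓕 a i ≡ 𝓕 b i → lookup a S ≢ lookup b S → Hidden i S
  𝓕-≡⇒hidden {S = S} i eq a≢bAtS = decidable-stable (hidden? i S) (a≢bAtS ∘ to (𝓕-≡⇔ i) eq S)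

  ∈⇒𝓕-≡ : ∀ {I a b i} → I ∈ 𝓘 → AgreeOutside (_≡ I) a b → i ∈ₛ I → 𝓕 a i ≡ 𝓕 b i
  ∈⇒𝓕-≡ {i = i} I∈𝓘 a~b i∈I = from (𝓕-≡⇔ i) λ S visible → a~b S λ { refl → visible (I∈𝓘 , i∈I) }

  ∈⇔𝓕-≡ : ∀ {I a b} i → I ∈ 𝓘 → AgreeOutside (_≡ I) a b → lookup a I ≢ lookup b I →
    i ∈ₛ I ⇔ 𝓕 a i ≡ 𝓕 b i
  ∈⇔𝓕-≡ i I∈𝓘 a~b a≢bAtI = mk⇔ (∈⇒𝓕-≡ I∈𝓘 a~b) (λ eq → proj₂ (𝓕-≡⇒hidden i eq a≢bAtI))

  visible-somewhere : ∀ S → ∃ λ i → ¬ Hidden i S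
  visible-somewhere S with S ∈𝓘? 𝓘
  ... | yes S∈𝓘 = Product.map₂ (_∘ proj₂) (∣p∣<n⇒∃∉ S (subst (_< k) (sym (All.lookup ∣𝓘∣≡ℓ S∈𝓘)) ℓ<k))
  ... | no S∉𝓘 = fromℕ< ℓ<k , S∉𝓘 ∘ proj₁

  𝓕-distinct : Distinct 𝓕
  𝓕-distinct a b a≢b 𝓕a≐𝓕b = a≢b (lookup-injective λ S →
    let i , visible = visible-somewhere S in to (𝓕-≡⇔ i) (toSet-≐⇒≗ 𝓕a≐𝓕b i) S visible)

  neighbour : Fin s → Subset k → Fin s
  neighbour a T = overwrite (_≟ₛ T) (punchIn (lookup a T) 0F) a

  agreeOutside-neighbour : ∀ {a T} → AgreeOutside (_≡ T) a (neighbour a T)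
  agreeOutside-neighbour S S≢T = sym (lookup∘overwrite′ (_≟ₛ _) _ S≢T)

  lookup-neighbour-≢ : ∀ {a T} → lookup a T ≢ lookup (neighbour a T) T
  lookup-neighbour-≢ {a} {T} eq =
    punchInᵢ≢i (lookup a T) 0F (trans (sym (lookup∘overwrite (_≟ₛ T) _ refl)) (sym eq))

  neighbour-≢ : ∀ {a T} → neighbour a T ≢ a
  neighbour-≢ {a} {T} eq = lookup-neighbour-≢ (cong (λ c → lookup c T) (sym eq))

  I∈projI : ∀ a {I} → I ∈ 𝓘 → InProjI 𝓕 a I
  I∈projI a I∈𝓘 = neighbour a _ , neighbour-≢ , λ i →
    ⇔.trans (∈⇔𝓕-≡ i I∈𝓘 agreeOutside-neighbour lookup-neighbour-≢)
            (⇔.sym (proj-∩⇔ (𝓕 a) (𝓕 (neighbour a _)) i))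

  module _ {a b : Fin s} {S : Subset k} (S⇔ : ∀ i → i ∈ₛ S ⇔ 𝓕 a i ≡ 𝓕 b i) where

    ⊆-difference : ∀ {T : Subset k} → lookup a T ≢ lookup b T → S ⊆ T
    ⊆-difference a≢bAtT {i} i∈S = proj₂ (𝓕-≡⇒hidden i (to (S⇔ i) i∈S) a≢bAtT)

    difference∈𝓘 : ∀ {i} {T : Subset k} → i ∈ₛ S → lookup a T ≢ lookup b T → T ∈ 𝓘
    difference∈𝓘 {i} i∈S a≢bAtT = proj₁ (𝓕-≡⇒hidden i (to (S⇔ i) i∈S) a≢bAtT)

    unique-difference⇒≡ : ∀ {T : Subset k} → T ∈ 𝓘 → lookup a T ≢ lookup b T →
      AgreeOutside (_≡ T) a b → S ≡ T
    unique-difference⇒≡ T∈𝓘 a≢bAtT a~b =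
      ⊆-antisym (⊆-difference a≢bAtT) λ {i} i∈T → from (S⇔ i) (to (∈⇔𝓕-≡ i T∈𝓘 a~b a≢bAtT) i∈T)

    agreement∈𝓘⊎small : b ≢ a → S ∈ 𝓘 ⊎ ∣ S ∣ < ℓ
    agreement∈𝓘⊎small b≢a with nonempty? S | ≢⇒∃lookup≢ {k} (≢-sym b≢a)
    ... | no ∄i | _ = inj₂ (subst (_< ℓ) (sym ∣S∣≡0) 0<ℓ)
      where
      ∣S∣≡0 : ∣ S ∣ ≡ 0
      ∣S∣≡0 = trans (cong ∣_∣ (Empty-unique ∄i)) (∣⊥∣≡0 k)
    ... | yes (i , i∈S) | T , a≢bAtT
      with anySubset? (λ T′ → ¬? (T′ ≟ₛ T) ×-dec ¬? (lookup a T′ ≟ᶠ lookup b T′))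
    ...   | yes (T′ , T′≢T , a≢bAtT′) = inj₂ (subst (∣ S ∣ <_) (∣T∣≡ℓ a≢bAtT)
            (⊆-distinct-equal-size⇒< (⊆-difference a≢bAtT) (⊆-difference a≢bAtT′) (≢-sym T′≢T)
              (trans (∣T∣≡ℓ a≢bAtT) (sym (∣T∣≡ℓ a≢bAtT′)))))
      where
      ∣T∣≡ℓ : ∀ {T : Subset k} → lookup a T ≢ lookup b T → ∣ T ∣ ≡ ℓ
      ∣T∣≡ℓ = All.lookup ∣𝓘∣≡ℓ ∘ difference∈𝓘 i∈S
    ...   | no ∄T′ = inj₁ (subst (_∈ 𝓘) (sym (unique-difference⇒≡ T∈𝓘 a≢bAtT a~b)) T∈𝓘)
      where
      T∈𝓘 : T ∈ 𝓘
      T∈𝓘 = difference∈𝓘 i∈S a≢bAtT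
      a~b : AgreeOutside (_≡ T) a b
      a~b T′ T′≢T = decidable-stable (lookup a T′ ≟ᶠ lookup b T′) (∄T′ ∘ (T′ ,_) ∘ (T′≢T ,_))

  𝓕-condB : ∀ a → CondB ℓ 𝓘 𝓕 a
  𝓕-condB a = (λ I → I∈projI a) , λ S (b , b≢a , S⇔) →
    agreement∈𝓘⊎small (λ i → ⇔.trans (S⇔ i) (proj-∩⇔ (𝓕 a) (𝓕 b) i)) b≢a

  module _ {I : Subset k} (I∈𝓘 : I ∈ 𝓘) where

    label : Fin s → ℕ
    label b = toℕ (overwrite (_≟ₛ I) 0F b)

    label-≡⇔ : ∀ {a b} → label b ≡ label a ⇔ AgreeOutside (_≡ I) b a
    label-≡⇔ = ⇔.trans (mk⇔ toℕ-injective (cong toℕ)) (overwrite-≡⇔ (_≟ₛ I) 0F)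

    onI : Fin s → SetOf k
    onI a (i , y) = i ∈ₛ I × y ≡ 𝓕 a i

    class-size : ∀ a → q ≤ length (filter (λ b → label b ℕ.≟ label a) (allFin s))
    class-size a = injection⇒≤-length-filter (λ b → label b ℕ.≟ label a) (λ t → overwrite (_≟ₛ I) t a)
      (λ t → from label-≡⇔ λ S S≢I → lookup∘overwrite′ (_≟ₛ I) t S≢I)
      (λ {t} {t′} eq → trans (sym (lookup∘overwrite (_≟ₛ I) t refl))
                             (trans (cong (λ c → lookup c I) eq) (lookup∘overwrite (_≟ₛ I) t′ refl)))

    ∩-same-class : ∀ {a b b′} → label b ≡ label a → label b′ ≡ label a → b ≢ b′ →
      (toSet (𝓕 b) ∩ toSet (𝓕 b′)) ≐ onI a
    ∩-same-class {a} {b} {b′} b∼a b′∼a b≢b′ (i , y) = mk⇔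
      (λ (𝓕bi≡y , 𝓕b′i≡y) → let i∈I = from (∈⇔𝓕-≡ i I∈𝓘 b~b′ b≢b′AtI) (trans 𝓕bi≡y (sym 𝓕b′i≡y)) in
        i∈I , trans (sym 𝓕bi≡y) (∈⇒𝓕-≡ I∈𝓘 b~a i∈I))
      (λ (i∈I , y≡𝓕ai) →
        trans (∈⇒𝓕-≡ I∈𝓘 b~a i∈I) (sym y≡𝓕ai) , trans (∈⇒𝓕-≡ I∈𝓘 b′~a i∈I) (sym y≡𝓕ai))
      where
      b~a : AgreeOutside (_≡ I) b a
      b~a = to label-≡⇔ b∼a
      b′~a : AgreeOutside (_≡ I) b′ a
      b′~a = to label-≡⇔ b′∼a
      b~b′ : AgreeOutside (_≡ I) b b′
      b~b′ S S≢I = trans (b~a S S≢I) (sym (b′~a S S≢I))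
      b≢b′AtI : lookup b I ≢ lookup b′ I
      b≢b′AtI = b≢b′ ∘ lookup-injectiveAt b~b′

    kernel-class : ∀ a → Kernel 𝓕 (λ b → label b ≡ label a) ≐ onI a
    kernel-class a (i , y) = mk⇔
      (λ K → to (∩-same-class refl a′∼a (≢-sym neighbour-≢) (i , y)) (K a refl , K a′ a′∼a))
      (λ (i∈I , y≡𝓕ai) b b∼a → trans (∈⇒𝓕-≡ I∈𝓘 (to label-≡⇔ b∼a) i∈I) (sym y≡𝓕ai))
      where
      a′ : Fin s
      a′ = neighbour a I
      a′∼a : label a′ ≡ label a
      a′∼a = from label-≡⇔ λ S S≢I → sym (agreeOutside-neighbour S S≢I)

    class-sunflower : ∀ a → Sunflower 𝓕 (λ b → label b ≡ label a)
    class-sunflower a b b′ b∼a b′∼a b≢b′ e =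
      ⇔.trans (∩-same-class b∼a b′∼a b≢b′ e) (⇔.sym (kernel-class a e))

    𝓕-sunflowerPartition : SunflowerPartition 𝓕 q I
    𝓕-sunflowerPartition = label , λ a → class-size a , class-sunflower a , 𝓕 a , kernel-class a

lemma4p1 : (k ℓ q : ℕ) → 2 ≤ ℓ → ℓ < k → 2 ≤ q →
    Σ ℕ λ s → (0 < s) ×
      ((𝓘 : List (Subset k)) → All (λ I → ∣ I ∣ ≡ ℓ) 𝓘 →
        Σ (Fin s → Member k) λ 𝓕 →
          Distinct 𝓕 ×
          (∀ a → CondB ℓ 𝓘 𝓕 a) ×
          (∀ I → I ∈ 𝓘 → SunflowerPartition 𝓕 q I))
lemma4p1 k ℓ (suc (suc q′)) 2≤ℓ ℓ<k (s≤s (s≤s z≤n)) = Size k , 0<Size , λ 𝓘 ∣𝓘∣≡ℓ →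
  let open Construction k ℓ q′ 𝓘 ∣𝓘∣≡ℓ ℓ<k (≤-trans (s≤s z≤n) 2≤ℓ) in
  𝓕 , 𝓕-distinct , 𝓕-condB , λ _ → 𝓕-sunflowerPartition
  where
  open Table (suc (suc q′)) using (Size; tabulate)
  0<Size : 0 < Size k
  0<Size = ℕ.>-nonZero⁻¹ (Size k) {{nonZeroIndex (tabulate {k} λ _ → 0F)}}
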